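{- For $n\ge2$, let $h_n$ be the arbor whose root vertex contains $n-1$ elements and which has exactly one other vertex, a leaf containing one element. Then the $h$-vector of $h_n$ is $$\sum_{j=0}^{n-1}\binom{n-1}{j}\binom{n}{j}X^j+\sum_{j=1}^{n}\binom{n-1}{j-1}^2X^j.$$
   Context: An arbor on a finite non-empty set $I$ is a rooted tree whose vertices are labeled by pairwise disjoint non-empty subsets of $I$ whose union is $I$; we identify a vertex with its label set. For a vertex $v$, $\mathscr{D}(v)$ is the union of the labels of all vertices whose path to the root passes through $v$ (including $v$). $P_t$ is the set of $a\in\mathbb{Z}^I$ with $a_i\ge0$ and $\sum_{i\in\mathscr{D}(v)}a_i\le|\mathscr{D}(v)|$ for every vertex $v$. The $h$-vector of $t$ is the polynomial $h_t(X)=\sum_{b\in P_t}X^{\mathrm{nz}(b)}$, where $\mathrm{nz}(b)$ is the number of non-zero coordinates of $b$. -}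

module Defs where

open import Data.Nat using (ℕ; zero; suc; _+_; _*_; _∸_; _≤_; _<_)
open import Data.Nat.Combinatorics using (_C_)
open import Data.Fin using (Fin; inject₁; fromℕ)
open import Data.List using (List; []; _∷_; [_]; _++_; concat; map; length; allFin)
open import Data.Nat.ListAction using (sum)
open import Data.List.Relation.Unary.All using (All)
open import Data.List.Relation.Unary.Any using (Any)
open import Data.List.Membership.Propositional using (_∈_)
open import Data.Vec using (Vec; lookup; toList)
open import Data.Product using (Σ; _×_)
open import Relation.Nullary using (¬_)
open import Relation.Binary.PropositionalEquality using (_≡_)

data Arbor (n : ℕ) : Set where
  node : List (Fin n) → List (Arbor n) → Arbor n

label : ∀ {n} → Arbor n → List (Fin n)
label (node l _) = l

mutual
  -- all vertices of the tree (each vertex represented by the subtree rooted at it)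
  vertices : ∀ {n} → Arbor n → List (Arbor n)
  vertices (node l cs) = node l cs ∷ verticesF cs

  verticesF : ∀ {n} → List (Arbor n) → List (Arbor n)
  verticesF [] = []
  verticesF (c ∷ cs) = vertices c ++ verticesF cs

𝒟 : ∀ {n} → Arbor n → List (Fin n)
𝒟 t = concat (map label (vertices t))

-- Well-formedness of an arbor on Fin n: labels non-empty, every element of
-- Fin n occurs exactly once among all labels (so labels are pairwise disjoint,
-- have no repetitions, and cover Fin n).
data Occurs1 {A : Set} (x : A) : List A → Set where
  here  : ∀ {xs} → ¬ (x ∈ xs) → Occurs1 x (x ∷ xs)
  there : ∀ {y xs} → ¬ (x ≡ y) → Occurs1 x xs → Occurs1 x (y ∷ xs)

IsArbor : ∀ {n} → Arbor n → Set
IsArbor {n} t = All (λ v → ¬ (label v ≡ [])) (vertices t)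
              × ((i : Fin n) → Occurs1 i (𝒟 t))

-- b ∈ P_t  (coordinates are natural numbers, so a_i ≥ 0 is automatic;
-- |𝒟(v)| is the length of the (repetition-free) list 𝒟 v)
InP : ∀ {n} → Arbor n → Vec ℕ n → Set
InP t b = All (λ v → sum (map (lookup b) (𝒟 v)) ≤ length (𝒟 v)) (vertices t)

nz : ∀ {n} → Vec ℕ n → ℕ
nz Data.Vec.[] = 0
nz (zero Data.Vec.∷ b) = nz b
nz (suc _ Data.Vec.∷ b) = suc (nz b)

-- The set of b ∈ P_t with exactly j non-zero coordinates; its cardinality
-- is the coefficient of X^j in the h-vector h_t(X).
HCoeffSet : ∀ {n} → Arbor n → ℕ → Set
HCoeffSet {n} t j = Σ (Vec ℕ n) (λ b → InP t b × nz b ≡ j)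

hArbor : (n : ℕ) → Arbor n
hArbor zero = node [] []
hArbor (suc m) = node (map inject₁ (allFin m)) [ node [ fromℕ m ] [] ]

-- coefficient of X^j in  Σ_{j=0}^{n-1} C(n-1,j) C(n,j) X^j + Σ_{j=1}^{n} C(n-1,j-1)^2 X^j
-- (binomials with k > n vanish, so the sums may run over all j)
expectedCoeff : ℕ → ℕ → ℕ
expectedCoeff n zero = ((n ∸ 1) C 0) * (n C 0)
expectedCoeff n (suc j) = ((n ∸ 1) C suc j) * (n C suc j) + ((n ∸ 1) C j) * ((n ∸ 1) C j)

-- Split b ∈ P_{h_n} at the leaf coordinate x = b_{n-1}: the leaf forces x ∈ {0, 1},
-- and the root bounds the sum of the remaining n - 1 coordinates by n - x.  So the
-- coefficient of X^j counts vectors in ℕ^(n-1) with j non-zero entries and sum ≤ n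
-- (x = 0), plus those with j - 1 non-zero entries and sum ≤ n - 1 (x = 1).  There
-- are C(k,j) C(c,j) vectors in ℕ^k with j non-zero entries and sum ≤ c: choose the
-- support, then a composition of a number ≤ c into j positive parts.  Bijectively,
-- this follows from Pascal's rule by splitting off the first coordinate, inducting on
-- k simultaneously with the variant with a slack variable s (vectors with
-- s + Σ b ≤ c), of which there are C(k,j) C(c+1,j+1).
module Submission where

open import Defs
open import Data.Nat using (ℕ; zero; suc; _+_; _*_; _≤_; z≤n; s≤s; s≤s⁻¹)
open import Data.Nat.Properties
  using (≤-irrelevant; ≡-irrelevant; suc-injective; +-identityʳ; +-comm; *-zeroʳ;
         *-distribʳ-+; *-distribˡ-+)
open import Data.Nat.Combinatorics using (_C_; nCk+nC[k+1]≡[n+1]C[k+1])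
open import Data.Nat.ListAction using (sum)
open import Data.Fin using (Fin; inject₁; fromℕ)
import Data.Fin as Fin
open import Data.Fin.Properties using (+↔⊎)
open import Data.Vec as Vec using (Vec; []; _∷_; _∷ʳ_; lookup; init; last; initLast)
open import Data.Vec.Properties using (init-∷ʳ; last-∷ʳ)
open import Data.List as List using (allFin; tabulate; length; [_])
open import Data.List.Properties using (map-++; length-++; map-tabulate; tabulate-cong; length-tabulate; length-map)
open import Data.Nat.ListAction.Properties using (sum-++)
open import Data.List.Relation.Unary.All as All using (All)
open import Data.Product using (Σ; _×_; _,_; proj₁; proj₂; map)
open import Data.Product.Function.Dependent.Propositional using (Σ-↔)
open import Data.Sum using (_⊎_; inj₁; inj₂)
open import Data.Sum.Function.Propositional using (_⊎-↔_)
open import Function using (_∘_; id)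
open import Data.Empty using (⊥-elim)
open import Function.Bundles using (_↔_; mk↔ₛ′)
open import Function.Properties.Inverse using (↔-trans; ↔-sym; ↔-refl)
open import Function.Related.TypeIsomorphisms using (Σ-assoc)
open import Relation.Nullary using (¬_; Irrelevant)
open import Relation.Binary.PropositionalEquality
  using (_≡_; refl; sym; trans; cong; cong₂; subst; subst₂; module ≡-Reasoning)

private
  variable
    A : Set
    k j c : ℕ

×-irrelevant : {B : Set} → Irrelevant A → Irrelevant B → Irrelevant (A × B)
×-irrelevant irrA irrB (a , b) (a′ , b′) = cong₂ _,_ (irrA a a′) (irrB b b′)

≤×≡-irrelevant : ∀ {a b m n} → Irrelevant (a ≤ b × m ≡ n)
≤×≡-irrelevant = ×-irrelevant ≤-irrelevant ≡-irrelevant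

prop-↔ : {B : Set} → Irrelevant A → Irrelevant B → (A → B) → (B → A) → A ↔ B
prop-↔ irrA irrB to from = mk↔ₛ′ to from (λ _ → irrB _ _) (λ _ → irrA _ _)

≤×≡-↔ : ∀ {a b m n a′ b′ m′ n′} →
        (a ≤ b → a′ ≤ b′) → (a′ ≤ b′ → a ≤ b) → (m ≡ n → m′ ≡ n′) → (m′ ≡ n′ → m ≡ n) →
        (a ≤ b × m ≡ n) ↔ (a′ ≤ b′ × m′ ≡ n′)
≤×≡-↔ f f⁻¹ g g⁻¹ = prop-↔ ≤×≡-irrelevant ≤×≡-irrelevant (map f g) (map f⁻¹ g⁻¹)

Σ-cong : {P Q : A → Set} → (∀ {x} → P x ↔ Q x) → Σ A P ↔ Σ A Q
Σ-cong P↔Q = Σ-↔ ↔-refl P↔Q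

Σ-empty : {P : A → Set} → (∀ x → ¬ P x) → Σ A P ↔ Fin 0
Σ-empty ¬P = mk↔ₛ′ (λ (x , p) → ⊥-elim (¬P x p)) (λ ()) (λ ()) (λ (x , p) → ⊥-elim (¬P x p))

⊎-Fin : ∀ {B : Set} {a b n} → A ↔ Fin a → B ↔ Fin b → a + b ≡ n → (A ⊎ B) ↔ Fin n
⊎-Fin A↔a B↔b refl = ↔-trans (A↔a ⊎-↔ B↔b) (↔-sym +↔⊎)

Σ-ℕ↔ : {P : ℕ → Set} → Σ ℕ P ↔ (P 0 ⊎ Σ ℕ (P ∘ suc))
Σ-ℕ↔ {P} = mk↔ₛ′ to from (λ { (inj₁ _) → refl ; (inj₂ _) → refl }) (λ { (zero , _) → refl ; (suc _ , _) → refl })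
  where
  to : Σ ℕ P → P 0 ⊎ Σ ℕ (P ∘ suc)
  to (zero , p) = inj₁ p
  to (suc x , p) = inj₂ (x , p)
  from : P 0 ⊎ Σ ℕ (P ∘ suc) → Σ ℕ P
  from (inj₁ p) = 0 , p
  from (inj₂ (x , p)) = suc x , p

Σ-ℕ≤1↔ : {P : ℕ → Set} → (∀ x → ¬ P (suc (suc x))) → Σ ℕ P ↔ (P 0 ⊎ P 1)
Σ-ℕ≤1↔ {P} ¬P≥2 = mk↔ₛ′ to from (λ { (inj₁ _) → refl ; (inj₂ _) → refl }) from∘to
  where
  to : Σ ℕ P → P 0 ⊎ P 1
  to (zero , p) = inj₁ p
  to (suc zero , p) = inj₂ p
  to (suc (suc x) , p) = ⊥-elim (¬P≥2 x p)
  from : P 0 ⊎ P 1 → Σ ℕ P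
  from (inj₁ p) = 0 , p
  from (inj₂ p) = 1 , p
  from∘to : ∀ xp → from (to xp) ≡ xp
  from∘to (zero , p) = refl
  from∘to (suc zero , p) = refl
  from∘to (suc (suc x) , p) = ⊥-elim (¬P≥2 x p)

Σ-Vec-∷↔ : {P : Vec A (suc k) → Set} → Σ (Vec A (suc k)) P ↔ Σ A λ x → Σ (Vec A k) (P ∘ (x ∷_))
Σ-Vec-∷↔ = mk↔ₛ′ (λ { (x ∷ u , p) → x , u , p }) (λ (x , u , p) → x ∷ u , p) (λ _ → refl) (λ { (_ ∷ _ , _) → refl })

∷ʳ↔ : (A × Vec A k) ↔ Vec A (suc k)
∷ʳ↔ = mk↔ₛ′ (λ (x , u) → u ∷ʳ x) (λ b → last b , init b)
  (λ b → sym (proj₂ (proj₂ (initLast b))))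
  (λ (x , u) → cong₂ _,_ (last-∷ʳ x u) (init-∷ʳ x u))

Σ-Vec-∷ʳ↔ : {P : Vec A (suc k) → Set} → Σ (Vec A (suc k)) P ↔ Σ A λ x → Σ (Vec A k) λ u → P (u ∷ʳ x)
Σ-Vec-∷ʳ↔ = ↔-trans (↔-sym (Σ-↔ ∷ʳ↔ ↔-refl)) Σ-assoc

Bounded : ℕ → ℕ → ℕ → Set
Bounded k j c = Σ (Vec ℕ k) λ b → Vec.sum b ≤ c × nz b ≡ j

BoundedWithSlack : ℕ → ℕ → ℕ → Set
BoundedWithSlack k j c = Σ ℕ λ s → Σ (Vec ℕ k) λ b → s + Vec.sum b ≤ c × nz b ≡ j

Bounded-split : Bounded (suc k) j c ↔
  (Bounded k j c ⊎ Σ ℕ λ y → Σ (Vec ℕ k) λ b → suc y + Vec.sum b ≤ c × suc (nz b) ≡ j)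
Bounded-split = ↔-trans Σ-Vec-∷↔ Σ-ℕ↔

Bounded-0-0↔ : Bounded 0 0 c ↔ Fin 1
Bounded-0-0↔ = mk↔ₛ′ (λ _ → Fin.zero) (λ _ → [] , z≤n , refl)
  (λ { Fin.zero → refl ; (Fin.suc ()) })
  (λ { ([] , p) → cong ([] ,_) (≤×≡-irrelevant _ p) })

weighted-pascal : ∀ k j m → (k C suc j) * m + (k C j) * m ≡ (suc k C suc j) * m
weighted-pascal k j m = begin
  (k C suc j) * m + (k C j) * m ≡⟨ *-distribʳ-+ m (k C suc j) (k C j) ⟨
  (k C suc j + k C j) * m       ≡⟨ cong (_* m) (+-comm (k C suc j) (k C j)) ⟩
  (k C j + k C suc j) * m       ≡⟨ cong (_* m) (nCk+nC[k+1]≡[n+1]C[k+1] k j) ⟩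
  (suc k C suc j) * m           ∎
  where open ≡-Reasoning

mutual
  Bounded↔ : ∀ k j c → Bounded k j c ↔ Fin ((k C j) * (c C j))
  Bounded↔ zero zero c = Bounded-0-0↔
  Bounded↔ zero (suc j) c = Σ-empty λ { [] (_ , ()) }
  Bounded↔ (suc k) zero c =
    ↔-trans Bounded-split (⊎-Fin (Bounded↔ k 0 c) (Σ-empty λ { _ (_ , _ , ()) }) refl)
  Bounded↔ (suc k) (suc j) zero =
    ↔-trans Bounded-split (⊎-Fin (Bounded↔ k (suc j) 0) (Σ-empty λ { _ (_ , () , _) }) eq)
    where
    eq : (k C suc j) * 0 + 0 ≡ (suc k C suc j) * 0
    eq = trans (+-identityʳ _) (trans (*-zeroʳ (k C suc j)) (sym (*-zeroʳ (suc k C suc j))))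
  Bounded↔ (suc k) (suc j) (suc c) =
    ↔-trans Bounded-split
      (⊎-Fin (Bounded↔ k (suc j) (suc c))
             (↔-trans (Σ-cong (Σ-cong (≤×≡-↔ s≤s⁻¹ s≤s suc-injective (cong suc))))
                      (BoundedWithSlack↔ k j c))
             (weighted-pascal k j (suc c C suc j)))

  BoundedWithSlack↔ : ∀ k j c → BoundedWithSlack k j c ↔ Fin ((k C j) * (suc c C suc j))
  BoundedWithSlack↔ k j zero =
    ↔-trans Σ-ℕ↔ (⊎-Fin (Bounded↔ k j 0) (Σ-empty λ { _ (_ , () , _) }) eq)
    where
    eq : (k C j) * (0 C j) + 0 ≡ (k C j) * (1 C suc j)
    eq = trans (+-identityʳ _) (cong ((k C j) *_) (trans (sym (+-identityʳ _)) (nCk+nC[k+1]≡[n+1]C[k+1] 0 j)))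
  BoundedWithSlack↔ k j (suc c) =
    ↔-trans Σ-ℕ↔
      (⊎-Fin (Bounded↔ k j (suc c))
             (↔-trans (Σ-cong (Σ-cong (≤×≡-↔ s≤s⁻¹ s≤s id id)))
                      (BoundedWithSlack↔ k j c))
             eq)
    where
    eq : (k C j) * (suc c C j) + (k C j) * (suc c C suc j) ≡ (k C j) * (suc (suc c) C suc j)
    eq = trans (sym (*-distribˡ-+ (k C j) (suc c C j) (suc c C suc j)))
               (cong ((k C j) *_) (nCk+nC[k+1]≡[n+1]C[k+1] (suc c) j))

lookup-∷ʳ-inject₁ : ∀ (u : Vec A k) x i → lookup (u ∷ʳ x) (inject₁ i) ≡ lookup u i
lookup-∷ʳ-inject₁ (y ∷ u) x Fin.zero = refl
lookup-∷ʳ-inject₁ (y ∷ u) x (Fin.suc i) = lookup-∷ʳ-inject₁ u x i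

lookup-∷ʳ-fromℕ : ∀ (u : Vec A k) x → lookup (u ∷ʳ x) (fromℕ k) ≡ x
lookup-∷ʳ-fromℕ [] x = refl
lookup-∷ʳ-fromℕ (y ∷ u) x = lookup-∷ʳ-fromℕ u x

sum-tabulate-lookup : ∀ (u : Vec ℕ k) → sum (tabulate (lookup u)) ≡ Vec.sum u
sum-tabulate-lookup [] = refl
sum-tabulate-lookup (x ∷ u) = cong (x +_) (sum-tabulate-lookup u)

nz-∷ʳ-zero : ∀ (u : Vec ℕ k) → nz (u ∷ʳ 0) ≡ nz u
nz-∷ʳ-zero [] = refl
nz-∷ʳ-zero (zero ∷ u) = nz-∷ʳ-zero u
nz-∷ʳ-zero (suc _ ∷ u) = cong suc (nz-∷ʳ-zero u)

nz-∷ʳ-suc : ∀ (u : Vec ℕ k) x → nz (u ∷ʳ suc x) ≡ suc (nz u)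
nz-∷ʳ-suc [] x = refl
nz-∷ʳ-suc (zero ∷ u) x = nz-∷ʳ-suc u x
nz-∷ʳ-suc (suc _ ∷ u) x = cong suc (nz-∷ʳ-suc u x)

sum-𝒟-hArbor : ∀ (u : Vec ℕ k) x → sum (List.map (lookup (u ∷ʳ x)) (𝒟 (hArbor (suc k)))) ≡ Vec.sum u + x
sum-𝒟-hArbor {k} u x = begin
  sum (List.map f (List.map inject₁ (allFin k) List.++ [ fromℕ k ]))
    ≡⟨ cong sum (map-++ f (List.map inject₁ (allFin k)) [ fromℕ k ]) ⟩
  sum (List.map f (List.map inject₁ (allFin k)) List.++ [ f (fromℕ k) ])
    ≡⟨ sum-++ (List.map f (List.map inject₁ (allFin k))) [ f (fromℕ k) ] ⟩
  sum (List.map f (List.map inject₁ (allFin k))) + (f (fromℕ k) + 0)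
    ≡⟨ cong₂ _+_ sum-init (trans (+-identityʳ _) (lookup-∷ʳ-fromℕ u x)) ⟩
  Vec.sum u + x ∎
  where
  open ≡-Reasoning
  f : Fin (suc k) → ℕ
  f = lookup (u ∷ʳ x)
  sum-init : sum (List.map f (List.map inject₁ (allFin k))) ≡ Vec.sum u
  sum-init = begin
    sum (List.map f (List.map inject₁ (tabulate id))) ≡⟨ cong (sum ∘ List.map f) (map-tabulate id inject₁) ⟩
    sum (List.map f (tabulate inject₁))              ≡⟨ cong sum (map-tabulate inject₁ f) ⟩
    sum (tabulate (f ∘ inject₁))                     ≡⟨ cong sum (tabulate-cong (lookup-∷ʳ-inject₁ u x)) ⟩
    sum (tabulate (lookup u))                        ≡⟨ sum-tabulate-lookup u ⟩
    Vec.sum u                                        ∎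

length-𝒟-hArbor : ∀ k → length (𝒟 (hArbor (suc k))) ≡ suc k
length-𝒟-hArbor k = begin
  length (List.map inject₁ (allFin k) List.++ [ fromℕ k ]) ≡⟨ length-++ (List.map inject₁ (allFin k)) ⟩
  length (List.map inject₁ (allFin k)) + 1                 ≡⟨ +-comm _ 1 ⟩
  suc (length (List.map inject₁ (allFin k)))               ≡⟨ cong suc (length-map inject₁ (allFin k)) ⟩
  suc (length (allFin k))                                  ≡⟨ cong suc (length-tabulate id) ⟩
  suc k                                                    ∎
  where open ≡-Reasoning

InP-hArbor⇒ : ∀ (u : Vec ℕ k) x → InP (hArbor (suc k)) (u ∷ʳ x) → Vec.sum u + x ≤ suc k × x ≤ 1
InP-hArbor⇒ {k} u x (root All.∷ leaf All.∷ All.[]) =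
  subst₂ _≤_ (sum-𝒟-hArbor u x) (length-𝒟-hArbor k) root ,
  subst (_≤ 1) (trans (+-identityʳ _) (lookup-∷ʳ-fromℕ u x)) leaf

InP-hArbor⇐ : ∀ (u : Vec ℕ k) x → Vec.sum u + x ≤ suc k × x ≤ 1 → InP (hArbor (suc k)) (u ∷ʳ x)
InP-hArbor⇐ {k} u x (root , leaf) =
  subst₂ _≤_ (sym (sum-𝒟-hArbor u x)) (sym (length-𝒟-hArbor k)) root All.∷
  subst (_≤ 1) (sym (trans (+-identityʳ _) (lookup-∷ʳ-fromℕ u x))) leaf All.∷ All.[]

hVector : ∀ k j → Vec ℕ (suc k) → Set
hVector k j b = InP (hArbor (suc k)) b × nz b ≡ j

hVector-irrelevant : ∀ b → Irrelevant (hVector k j b)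
hVector-irrelevant b = ×-irrelevant (All.irrelevant ≤-irrelevant) ≡-irrelevant

hVector-leaf≤1 : ∀ (u : Vec ℕ k) x → ¬ hVector k j (u ∷ʳ suc (suc x))
hVector-leaf≤1 u x (p , _) with InP-hArbor⇒ u (suc (suc x)) p
... | _ , s≤s ()

hVector-leaf0 : ∀ (u : Vec ℕ k) → hVector k j (u ∷ʳ 0) ↔ (Vec.sum u ≤ suc k × nz u ≡ j)
hVector-leaf0 {k} {j} u = prop-↔ (hVector-irrelevant (u ∷ʳ 0)) ≤×≡-irrelevant to from
  where
  to : hVector k j (u ∷ʳ 0) → Vec.sum u ≤ suc k × nz u ≡ j
  to (p , e) = subst (_≤ suc k) (+-identityʳ _) (proj₁ (InP-hArbor⇒ u 0 p)) ,
               trans (sym (nz-∷ʳ-zero u)) e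
  from : Vec.sum u ≤ suc k × nz u ≡ j → hVector k j (u ∷ʳ 0)
  from (s , e) = InP-hArbor⇐ u 0 (subst (_≤ suc k) (sym (+-identityʳ _)) s , z≤n) ,
                 trans (nz-∷ʳ-zero u) e

hVector-leaf1 : ∀ (u : Vec ℕ k) → hVector k j (u ∷ʳ 1) ↔ (Vec.sum u ≤ k × suc (nz u) ≡ j)
hVector-leaf1 {k} {j} u = prop-↔ (hVector-irrelevant (u ∷ʳ 1)) ≤×≡-irrelevant to from
  where
  to : hVector k j (u ∷ʳ 1) → Vec.sum u ≤ k × suc (nz u) ≡ j
  to (p , e) = s≤s⁻¹ (subst (_≤ suc k) (+-comm (Vec.sum u) 1) (proj₁ (InP-hArbor⇒ u 1 p))) ,
               trans (sym (nz-∷ʳ-suc u 0)) e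
  from : Vec.sum u ≤ k × suc (nz u) ≡ j → hVector k j (u ∷ʳ 1)
  from (s , e) = InP-hArbor⇐ u 1 (subst (_≤ suc k) (+-comm 1 (Vec.sum u)) (s≤s s) , s≤s z≤n) ,
                 trans (nz-∷ʳ-suc u 0) e

HCoeffSet-hArbor-split : HCoeffSet (hArbor (suc k)) j ↔
  (Bounded k j (suc k) ⊎ Σ (Vec ℕ k) λ u → Vec.sum u ≤ k × suc (nz u) ≡ j)
HCoeffSet-hArbor-split =
  ↔-trans Σ-Vec-∷ʳ↔
    (↔-trans (Σ-ℕ≤1↔ λ x (u , p) → hVector-leaf≤1 u x p)
             (Σ-cong (λ {u} → hVector-leaf0 u) ⊎-↔ Σ-cong (λ {u} → hVector-leaf1 u)))

HCoeffSet-hArbor↔ : ∀ k j → HCoeffSet (hArbor (suc k)) j ↔ Fin (expectedCoeff (suc k) j)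
HCoeffSet-hArbor↔ k zero =
  ↔-trans HCoeffSet-hArbor-split
    (⊎-Fin (Bounded↔ k 0 (suc k)) (Σ-empty λ { _ (_ , ()) }) (+-identityʳ _))
HCoeffSet-hArbor↔ k (suc j) =
  ↔-trans HCoeffSet-hArbor-split
    (⊎-Fin (Bounded↔ k (suc j) (suc k))
           (↔-trans (Σ-cong (≤×≡-↔ id id suc-injective (cong suc)))
                    (Bounded↔ k j k))
           refl)

-- The count already holds for n = 1; the hypothesis 2 ≤ n only excludes n = 0.
proposition8p3 : (n : ℕ) → 2 ≤ n →
    (j : ℕ) → HCoeffSet (hArbor n) j ↔ Fin (expectedCoeff n j)
proposition8p3 (suc k) _ j = HCoeffSet-hArbor↔ k j
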